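{- Let $n\in\mathbb{N}\cup\{\infty\}$. For every $a:V^n$, the type $\mathrm{El}^n\,a$ is an $n$-type.
   Context: Homotopy type theory with univalent universes $U:\mathsf{Type}$ and function extensionality; $\infty\pm1=\infty$ and every type is an $\infty$-type. A map is $k$-truncated if its homotopy fibers are $k$-types. Let $V^\infty:=W_{A:U}A$, the W-type with constructor $\sup^\infty:\sum_{A:U}(A\to V^\infty)\to V^\infty$. For $k\ge-1$ define by induction the proposition $\mathrm{isIt}_k(\sup^\infty(A,f)):=(f\text{ is }k\text{ -truncated})\times\prod_{a:A}\mathrm{isIt}_k(f\,a)$ and $V^{k+1}:=\sum_{x:V^\infty}\mathrm{isIt}_k\,x$ (a subtype of $V^\infty$). The decoding $\mathrm{El}^n:V^n\to U$ is given by $\mathrm{El}^n(\sup^\infty(A,f),p):=A$ (for $n=\infty$, $\mathrm{El}^\infty(\sup^\infty(A,f)):=A$). -}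

{-# OPTIONS --without-K #-}
module Defs where

open import Level using (Level; _⊔_; Lift; Setω) renaming (suc to lsuc; zero to lzero)
open import Data.Nat using (ℕ; zero; suc)
open import Data.Product using (Σ; _×_; _,_; proj₁; proj₂)
open import Data.Unit using (⊤)
open import Relation.Binary.PropositionalEquality using (_≡_; refl)

isContr : ∀ {ℓ} → Set ℓ → Set ℓ
isContr A = Σ A (λ c → (x : A) → c ≡ x)

data TLevel : Set where
  ⟨-2⟩ : TLevel
  S    : TLevel → TLevel

is-_-type : ∀ {ℓ} → TLevel → Set ℓ → Set ℓ
is- ⟨-2⟩ -type A = isContr A
is- S k -type A = (x y : A) → is- k -type (x ≡ y)

fiber : ∀ {a b} {A : Set a} {B : Set b} → (A → B) → B → Set (a ⊔ b)
fiber {A = A} f y = Σ A (λ x → f x ≡ y)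

is-_-truncated : ∀ {a b} {A : Set a} {B : Set b} → TLevel → (A → B) → Set (a ⊔ b)
is- k -truncated f = ∀ y → is- k -type (fiber f y)

-- the truncation level  n - 1  for  n : ℕ   (so levelPred 0 = -1)
levelPred : ℕ → TLevel
levelPred zero    = S ⟨-2⟩
levelPred (suc n) = S (levelPred n)

level : ℕ → TLevel
level n = S (levelPred n)

idfun : ∀ {ℓ} (A : Set ℓ) → A → A
idfun A x = x

isEquiv : ∀ {a b} {A : Set a} {B : Set b} → (A → B) → Set (a ⊔ b)
isEquiv f = ∀ y → isContr (fiber f y)

_≃_ : ∀ {a b} → Set a → Set b → Set (a ⊔ b)
A ≃ B = Σ (A → B) isEquiv

idIsEquiv : ∀ {ℓ} (A : Set ℓ) → isEquiv (idfun A)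
idIsEquiv A y = (y , refl) , λ { (.y , refl) → refl }

idtoeqv : {A B : Set} → A ≡ B → A ≃ B
idtoeqv {A} refl = idfun A , idIsEquiv A

Univalence : Set₁
Univalence = (A B : Set) → isEquiv (idtoeqv {A} {B})

happly : ∀ {a b} {A : Set a} {B : A → Set b} {f g : (x : A) → B x} →
         f ≡ g → (x : A) → f x ≡ g x
happly refl x = refl

FunExt : Setω
FunExt = ∀ {a b} {A : Set a} {B : A → Set b} (f g : (x : A) → B x) → isEquiv (happly {f = f} {g = g})

data ℕ∞ : Set where
  fin : ℕ → ℕ∞
  ∞   : ℕ∞

is-_-typeₙ : ∀ {ℓ} → ℕ∞ → Set ℓ → Set ℓ
is- fin n -typeₙ A = is- level n -type A
is- ∞ -typeₙ A = Lift _ ⊤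

data V∞ : Set₁ where
  sup∞ : (A : Set) → (A → V∞) → V∞

-- isIt_k with k = n - 1 (n : ℕ, so k ≥ -1)
isIt : ℕ → V∞ → Set₁
isIt n (sup∞ A f) = is- levelPred n -truncated f × ((a : A) → isIt n (f a))

-- V^n for n : ℕ ∪ {∞};  V^{k+1} = Σ (x : V^∞) isIt_k x
V : ℕ∞ → Set₁
V (fin n) = Σ V∞ (isIt n)
V ∞       = V∞

El : (n : ℕ∞) → V n → Set
El (fin n) (sup∞ A f , p) = A
El ∞ (sup∞ A f) = A

{-# OPTIONS --without-K #-}

-- For a = (sup∞ A f , p) : V^n the map f : A → V∞ is (n-1)-truncated, and by univalence a path
-- v ≡ f y in V∞ amounts to an equivalence of index types together with a family of fibres of
-- f y's branching map, so it is an (n-1)-type as well. A map whose fibres and whose paths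
-- between images are k-types has a (k+1)-type as domain, hence A is an n-type.
module Submission where

open import Defs
open import Level using (Level; _⊔_; lift)
open import Data.Nat using (ℕ; zero; suc)
open import Data.Product using (Σ; _,_; proj₁; proj₂)
open import Data.Unit using (tt)
open import Function using (_∘_)
open import Relation.Binary.PropositionalEquality using (_≡_; refl; sym; trans; cong; subst)
open import Relation.Binary.PropositionalEquality.Properties using (trans-symˡ)

private variable
  ℓ ℓ′ : Level

is-type-retract : {X : Set ℓ} {Y : Set ℓ′} (k : TLevel) (r : X → Y) (s : Y → X) →
  (∀ y → r (s y) ≡ y) → is- k -type X → is- k -type Y
is-type-retract ⟨-2⟩ r s rs (c , p) = r c , λ y → trans (cong r (p (s y))) (rs y)
is-type-retract (S k) r s rs h y y′ = is-type-retract k r′ (cong s) r′∘cong-s (h (s y) (s y′))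
  where
  r′ : s y ≡ s y′ → y ≡ y′
  r′ q = trans (sym (rs y)) (trans (cong r q) (rs y′))
  r′∘cong-s : (q : y ≡ y′) → r′ (cong s q) ≡ q
  r′∘cong-s refl = trans-symˡ (rs y)

is-type-cumulative : {X : Set ℓ} (k : TLevel) → is- k -type X → is- S k -type X
is-type-cumulative ⟨-2⟩ (c , p) x y = trans (sym (p x)) (p y) , λ { refl → trans-symˡ (p x) }
is-type-cumulative (S k) h x y = is-type-cumulative k (h x y)

prop⇒is-levelPred-type : {P : Set ℓ} (n : ℕ) → is- S ⟨-2⟩ -type P → is- levelPred n -type P
prop⇒is-levelPred-type zero    h = h
prop⇒is-levelPred-type (suc n) h = is-type-cumulative (levelPred n) (prop⇒is-levelPred-type n h)

singleton-isContr : {X : Set ℓ} (x : X) → isContr (Σ X (x ≡_))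
singleton-isContr x = (x , refl) , λ { (y , refl) → refl }

singletonʳ-isContr : {X : Set ℓ} (x : X) → isContr (Σ X (_≡ x))
singletonʳ-isContr x = (x , refl) , λ { (y , refl) → refl }

module _ {X : Set ℓ} {B : X → Set ℓ′} where

  Σ-Path : Σ X B → Σ X B → Set (ℓ ⊔ ℓ′)
  Σ-Path (x , b) (x′ , b′) = Σ (x ≡ x′) (λ p → subst B p b ≡ b′)

  Σ-Path→≡ : (u v : Σ X B) → Σ-Path u v → u ≡ v
  Σ-Path→≡ u v (refl , refl) = refl

  ≡→Σ-Path : (u v : Σ X B) → u ≡ v → Σ-Path u v
  ≡→Σ-Path u .u refl = refl , refl

  Σ-Path→≡∘≡→Σ-Path : (u v : Σ X B) (q : u ≡ v) → Σ-Path→≡ u v (≡→Σ-Path u v q) ≡ q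
  Σ-Path→≡∘≡→Σ-Path u .u refl = refl

Σ-is-type : {X : Set ℓ} {B : X → Set ℓ′} (k : TLevel) →
  is- k -type X → (∀ x → is- k -type (B x)) → is- k -type (Σ X B)
Σ-is-type ⟨-2⟩ (c , p) hB =
  (c , proj₁ (hB c)) , λ { (x , b) → Σ-Path→≡ _ _ (p x , trans (sym (proj₂ (hB x) _)) (proj₂ (hB x) b)) }
Σ-is-type {B = B} (S k) hX hB (x , b) (x′ , b′) =
  is-type-retract k (Σ-Path→≡ _ _) (≡→Σ-Path _ _) (Σ-Path→≡∘≡→Σ-Path _ _)
    (Σ-is-type k (hX x x′) (λ p → hB x′ (subst B p b) b′))

Σ-isContr : {X : Set ℓ} {B : X → Set ℓ′} (c : isContr X) → isContr (B (proj₁ c)) → isContr (Σ X B)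
Σ-isContr {B = B} c hB = Σ-is-type ⟨-2⟩ c (λ x → subst (isContr ∘ B) (proj₂ c x) hB)

module _ (fe : FunExt) where

  funext : {A : Set ℓ} {B : A → Set ℓ′} {f g : (x : A) → B x} → (∀ x → f x ≡ g x) → f ≡ g
  funext {f = f} {g} h = proj₁ (proj₁ (fe f g h))

  happly∘funext : {A : Set ℓ} {B : A → Set ℓ′} {f g : (x : A) → B x}
    (h : ∀ x → f x ≡ g x) → happly (funext h) ≡ h
  happly∘funext {f = f} {g} h = proj₂ (proj₁ (fe f g h))

  funext∘happly : {A : Set ℓ} {B : A → Set ℓ′} {f g : (x : A) → B x}
    (q : f ≡ g) → funext (happly q) ≡ q
  funext∘happly {f = f} {g} q = cong proj₁ (proj₂ (fe f g (happly q)) (q , refl))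

  Π-is-type : {A : Set ℓ} {B : A → Set ℓ′} (k : TLevel) →
    (∀ a → is- k -type (B a)) → is- k -type ((a : A) → B a)
  Π-is-type ⟨-2⟩ h = (λ a → proj₁ (h a)) , λ f → funext (λ a → proj₂ (h a) (f a))
  Π-is-type (S k) h f g =
    is-type-retract k funext happly funext∘happly (Π-is-type k (λ a → h a (f a) (g a)))

  isContr⇒isContr-isContr : {X : Set ℓ} → isContr X → isContr (isContr X)
  isContr⇒isContr-isContr c =
    Σ-is-type ⟨-2⟩ c (λ x → Π-is-type ⟨-2⟩ (λ y → is-type-cumulative ⟨-2⟩ c x y))

  isContr-isProp : {X : Set ℓ} → is- S ⟨-2⟩ -type (isContr X)
  isContr-isProp c = is-type-cumulative ⟨-2⟩ (isContr⇒isContr-isContr c) c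

  isEquiv-isProp : {A : Set ℓ} {B : Set ℓ′} (h : A → B) → is- S ⟨-2⟩ -type (isEquiv h)
  isEquiv-isProp h = Π-is-type (S ⟨-2⟩) (λ y → isContr-isProp)

-- Fundamental theorem of identity types; the retraction composes the two paths to the centre.
total-isContr⇒≡-is-type : {W : Set ℓ} {P : W → Set ℓ′} (v : W) (s : ∀ w → v ≡ w → P w) →
  isContr (Σ W P) → (k : TLevel) (w : W) → is- k -type (P w) → is- k -type (v ≡ w)
total-isContr⇒≡-is-type {P = P} v s (c , p) k w = is-type-retract k r (s w) r∘s
  where
  r : P w → v ≡ w
  r t = cong proj₁ (trans (sym (p (v , s v refl))) (p (w , t)))
  r∘s : ∀ q → r (s w q) ≡ q
  r∘s refl = cong (cong proj₁) (trans-symˡ (p (v , s v refl)))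

_≅V_ : V∞ → V∞ → Set₁
sup∞ A f ≅V sup∞ B g = Σ (A ≃ B) (λ e → (a : A) → g (proj₁ e a) ≡ f a)

≡→≅V : (v w : V∞) → v ≡ w → v ≅V w
≡→≅V (sup∞ A f) .(sup∞ A f) refl = idtoeqv refl , λ a → refl

module _ (ua : Univalence) (fe : FunExt) where

  ≃-total-isContr : (A : Set) → isContr (Σ Set (A ≃_))
  ≃-total-isContr A = is-type-retract ⟨-2⟩
    (λ { (B , p) → B , idtoeqv p })
    (λ { (B , e) → B , proj₁ (proj₁ (ua A B e)) })
    (λ { (B , e) → cong (B ,_) (proj₂ (proj₁ (ua A B e))) })
    (singleton-isContr A)

  homotopic-total-isContr : {A : Set} (f : A → V∞) →
    isContr (Σ (A → V∞) (λ g → (a : A) → g a ≡ f a))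
  homotopic-total-isContr f = is-type-retract ⟨-2⟩
    (λ { (g , p) → g , happly p })
    (λ { (g , h) → g , funext fe h })
    (λ { (g , h) → cong (g ,_) (happly∘funext fe h) })
    (singletonʳ-isContr f)

  ≅V-total-isContr : (A : Set) (f : A → V∞) → isContr (Σ V∞ (sup∞ A f ≅V_))
  ≅V-total-isContr A f = is-type-retract ⟨-2⟩
    (λ { ((B , e) , (g , h)) → sup∞ B g , (e , h) })
    (λ { (sup∞ B g , (e , h)) → (B , e) , (g , h) })
    (λ { (sup∞ B g , _) → refl })
    (Σ-isContr (≃-total-isContr A) (homotopic-total-isContr f))

  -- v ≅V sup∞ B g is reorganised as Σ (P : ∀ a → fiber g (f a)) (isEquiv (proj₁ ∘ P)).
  ≅V-is-type : (n : ℕ) (v w : V∞) → isIt n w → is- levelPred n -type (v ≅V w)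
  ≅V-is-type n (sup∞ _ f) (sup∞ _ g) (g-truncated , _) =
    is-type-retract (levelPred n)
      (λ { (P , P-equiv) → ((proj₁ ∘ P) , P-equiv) , (proj₂ ∘ P) })
      (λ { ((e , e-equiv) , h) → (λ a → e a , h a) , e-equiv })
      (λ _ → refl)
      (Σ-is-type (levelPred n)
        (Π-is-type fe (levelPred n) (g-truncated ∘ f))
        (λ P → prop⇒is-levelPred-type n (isEquiv-isProp fe (proj₁ ∘ P))))

  V∞-≡-is-type : (n : ℕ) (v w : V∞) → isIt n w → is- levelPred n -type (v ≡ w)
  V∞-≡-is-type n (sup∞ A f) w w-isIt =
    total-isContr⇒≡-is-type (sup∞ A f) (≡→≅V (sup∞ A f)) (≅V-total-isContr A f)
      (levelPred n) w (≅V-is-type n (sup∞ A f) w w-isIt)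

-- x ≡ y is a retract of Σ (p : f x ≡ f y) ((x , p) ≡ (y , refl)), paths in the fibre over f y.
truncated⇒domain-is-S-type : {A : Set ℓ} {B : Set ℓ′} (k : TLevel) (f : A → B) →
  is- k -truncated f → (∀ x y → is- k -type (f x ≡ f y)) → is- S k -type A
truncated⇒domain-is-S-type k f f-truncated image-paths x y =
  is-type-retract k (λ { (_ , q) → cong proj₁ q }) s (λ { refl → refl })
    (Σ-is-type k (image-paths x y)
      (λ p → is-type-cumulative k (f-truncated (f y)) (x , p) (y , refl)))
  where
  s : x ≡ y → Σ (f x ≡ f y) (λ p → _≡_ {A = fiber f (f y)} (x , p) (y , refl))
  s refl = refl , refl

mainTheorem9 : Univalence → FunExt →
    (n : ℕ∞) (a : V n) → is- n -typeₙ (El n a)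
mainTheorem9 ua fe ∞ a = lift tt
mainTheorem9 ua fe (fin n) (sup∞ A f , (f-truncated , f-isIt)) =
  truncated⇒domain-is-S-type (levelPred n) f f-truncated
    (λ x y → V∞-≡-is-type ua fe n (f x) (f y) (f-isIt y))
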